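{- For an integer $q\ge 3$, let $L'(q)$ be the minimum, over all infinite 2D words $w$ with $|Alph(w)|=q$ that have at least one non-trivial HV-palindromic factor, of the number of distinct non-empty HV-palindromic factors of $w$. Then $L'(3)=5$ and $L'(q)=q+1$ for every $q>3$.
   Context: An infinite 2D word over a finite alphabet $\Sigma$ is an array $w=[w_{i,j}]_{i,j\ge 1}$ with entries in $\Sigma$. $Alph(w)$ is the set of letters occurring in $w$. A factor of $w$ is a finite sub-array of consecutive rows and columns, considered as a finite 2D word; factors are counted as distinct arrays, independently of their positions. A 1D word is a palindrome if it equals its reversal, and a finite 2D word is an HV-palindrome if each of its rows and each of its columns is a 1D palindrome. An HV-palindromic factor is trivial if it has size $(1,1)$ (a single letter) and non-trivial otherwise. -}

module Defs where

open import Data.Nat using (ℕ; _+_; _≥_; _>_)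
open import Data.Fin using (Fin; toℕ)
open import Data.Vec using (Vec; tabulate; reverse; transpose)
open import Data.Vec.Relation.Unary.All using () renaming (All to AllV)
open import Data.List using (List; length)
open import Data.List.Relation.Unary.All using (All)
open import Data.List.Relation.Unary.Unique.Propositional using (Unique)
open import Data.List.Membership.Propositional using (_∈_)
open import Data.Product using (Σ; ∃; _×_; _,_)
open import Relation.Binary.PropositionalEquality using (_≡_)
open import Relation.Nullary using (¬_)

Word2D : Set → Set
Word2D A = ℕ → ℕ → A

Array : Set → Set
Array A = Σ ℕ λ m → Σ ℕ λ n → Vec (Vec A n) m

block : {A : Set} → Word2D A → ℕ → ℕ → (m n : ℕ) → Vec (Vec A n) m
block w i j m n = tabulate λ a → tabulate λ b → w (i + toℕ a) (j + toℕ b)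

IsFactor : {A : Set} → Word2D A → Array A → Set
IsFactor w (m , n , M) =
  m ≥ 1 × n ≥ 1 × ∃ λ i → ∃ λ j → M ≡ block w i j m n

Palindrome : {A : Set} {n : ℕ} → Vec A n → Set
Palindrome v = reverse v ≡ v

HVPalindrome : {A : Set} → Array A → Set
HVPalindrome (m , n , M) = AllV Palindrome M × AllV Palindrome (transpose M)

HVPalFactor : {A : Set} → Word2D A → Array A → Set
HVPalFactor w F = IsFactor w F × HVPalindrome F

NonTrivial : {A : Set} → Array A → Set
NonTrivial (m , n , M) = ¬ (m ≡ 1 × n ≡ 1)

HasNonTrivialHVPal : {A : Set} → Word2D A → Set
HasNonTrivialHVPal w = ∃ λ F → HVPalFactor w F × NonTrivial F

-- Alph(w) = the whole alphabet Fin q, i.e. |Alph(w)| = q (after renaming letters)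
UsesAll : {q : ℕ} → Word2D (Fin q) → Set
UsesAll {q} w = (a : Fin q) → ∃ λ i → ∃ λ j → w i j ≡ a

AtLeastHVPal : {A : Set} → Word2D A → ℕ → Set
AtLeastHVPal w k = ∃ λ (xs : List (Array _)) →
  length xs ≡ k × Unique xs × All (HVPalFactor w) xs

ExactlyHVPal : {A : Set} → Word2D A → ℕ → Set
ExactlyHVPal w k = ∃ λ (xs : List (Array _)) →
  length xs ≡ k × Unique xs × All (HVPalFactor w) xs ×
  (∀ F → HVPalFactor w F → F ∈ xs)

L'≡ : ℕ → ℕ → Set
L'≡ q k =
  (∃ λ (w : Word2D (Fin q)) → UsesAll w × HasNonTrivialHVPal w × ExactlyHVPal w k)
  × ((w : Word2D (Fin q)) → UsesAll w → HasNonTrivialHVPal w → AtLeastHVPal w k)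

-- The q letters are trivial HV-palindromic factors, and a non-trivial one adds a
-- (q + 1)-st. A non-trivial HV-palindrome has a row or a column of length at least 2, whose centre
-- is xx or xyx. Over three letters, put such a horizontal factor on top of a 3×3 window: if the
-- three columns and the two lower rows of the window each had three distinct letters, they would
-- form a Latin rectangle forcing distinct letters on top as well; so the window holds a second,
-- different short palindrome, which gives 3 + 2 = 5.
--
-- If no row and no column contains a factor xyx or xyyx, every palindromic row or
-- column has length at most 2, so the only non-trivial HV-palindromes are xx, its transpose and
-- constant 2×2 squares. This happens for (i , j) ↦ pat4 (i + j) with pat4 = 0012 0012 …, whose
-- non-trivial HV-palindromes are 00 and its transpose, and for (i , j) ↦ pat8 (2i + j) with
-- pat8 = 0012 3123 …, whose columns avoid xx, so that only 00 remains; the remaining q − 4 letters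
-- are written once each into row 0, which creates no new repetition.

module Submission where

open import Defs
open import Data.Empty using (⊥; ⊥-elim)
open import Data.Fin using (Fin; zero; suc; toℕ; fromℕ; fromℕ<; inject₁; opposite)
open import Data.Fin.Properties using (toℕ-fromℕ<; opposite-prop; _≟_; all?; toℕ-injective; toℕ<n)
open import Data.List as List using (List; []; _∷_; _++_; length; allFin)
open import Data.List.Membership.Propositional using (_∈_)
open import Data.List.Membership.Propositional.Properties using (∈-map⁻; ∈-map⁺; ∈-allFin; ∈-++⁺ˡ; ∈-++⁺ʳ)
open import Data.List.Properties using (length-++; length-map; length-tabulate)
open import Data.List.Relation.Binary.Disjoint.Propositional using (Disjoint)
open import Data.List.Relation.Unary.All as All using (All; []; _∷_)
import Data.List.Relation.Unary.All.Properties as All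
open import Data.List.Relation.Unary.AllPairs using ([]; _∷_)
open import Data.List.Relation.Unary.Any using (here; there)
open import Data.List.Relation.Unary.Unique.Propositional using (Unique)
import Data.List.Relation.Unary.Unique.Propositional.Properties as Unique
open import Data.Nat using (ℕ; zero; suc; _+_; _*_; _∸_; _<_; _>_; _<?_; s≤s; z≤n; NonZero; >-nonZero⁻¹)
open import Data.Nat.Induction using (<-rec)
open import Data.Nat.Properties
  using (m+n∸m≡n; m≤m+n; +-suc; +-comm; +-identityʳ; <⇒≢; m<n+m; ≮⇒≥; m+[n∸m]≡n; ∸-monoʳ-<; +-monoʳ-<;
         ≤-trans; +-cancelˡ-≡; m+n≮m; allUpTo?)
import Data.Nat.Properties as ℕ
open import Data.Product using (∃; ∃₂; _×_; _,_; proj₁; proj₂)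
open import Data.Sum using (_⊎_; inj₁; inj₂)
open import Data.Vec using (Vec; []; _∷_; lookup; tabulate; reverse; transpose; _∷ʳ_; replicate; _⊛_; map)
import Data.Vec as Vec
open import Data.Vec.Properties
  using (reverse-∷; lookup-⊛; lookup-replicate; lookup-map; lookup∘tabulate; tabulate-cong)
open import Data.Vec.Relation.Unary.All using ([]; _∷_)
open import Data.Vec.Relation.Unary.All.Properties using (lookup⁺)
open import Function using (_∘_; id)
open import Relation.Binary.Definitions using (DecidableEquality)
open import Relation.Binary.PropositionalEquality
  using (_≡_; _≢_; refl; sym; trans; cong; cong₂; subst; module ≡-Reasoning)
open import Relation.Nullary using (¬_; ¬?; yes; no)
open import Relation.Nullary.Decidable using (from-yes; _→-dec_; True; toWitness)
open import Relation.Unary using (Decidable)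

private variable
  A : Set
  m n : ℕ

lookup-∷ʳ-inject₁ : (xs : Vec A n) (x : A) (k : Fin n) → lookup (xs ∷ʳ x) (inject₁ k) ≡ lookup xs k
lookup-∷ʳ-inject₁ (y ∷ ys) x zero = refl
lookup-∷ʳ-inject₁ (y ∷ ys) x (suc k) = lookup-∷ʳ-inject₁ ys x k

lookup-∷ʳ-last : (xs : Vec A n) (x : A) → lookup (xs ∷ʳ x) (fromℕ n) ≡ x
lookup-∷ʳ-last [] x = refl
lookup-∷ʳ-last (y ∷ ys) x = lookup-∷ʳ-last ys x

lookup-reverse : (xs : Vec A n) (k : Fin n) → lookup (reverse xs) (opposite k) ≡ lookup xs k
lookup-reverse {n = suc n} (x ∷ xs) zero = begin
  lookup (reverse (x ∷ xs)) (fromℕ n)   ≡⟨ cong (λ v → lookup v (fromℕ n)) (reverse-∷ x xs) ⟩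
  lookup (reverse xs ∷ʳ x) (fromℕ n)    ≡⟨ lookup-∷ʳ-last (reverse xs) x ⟩
  x                                     ∎
  where open ≡-Reasoning
lookup-reverse (x ∷ xs) (suc k) = begin
  lookup (reverse (x ∷ xs)) (inject₁ (opposite k))
    ≡⟨ cong (λ v → lookup v (inject₁ (opposite k))) (reverse-∷ x xs) ⟩
  lookup (reverse xs ∷ʳ x) (inject₁ (opposite k))
    ≡⟨ lookup-∷ʳ-inject₁ (reverse xs) x (opposite k) ⟩
  lookup (reverse xs) (opposite k)
    ≡⟨ lookup-reverse xs k ⟩
  lookup xs k
    ∎
  where open ≡-Reasoning

lookup-transpose : (M : Vec (Vec A n) m) (c : Fin n) → lookup (transpose M) c ≡ map (λ row → lookup row c) M
lookup-transpose [] c = lookup-replicate c []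
lookup-transpose {n = n} (row ∷ M) c = begin
  lookup (replicate n Vec._∷_ ⊛ row ⊛ transpose M) c
    ≡⟨ lookup-⊛ c (replicate n Vec._∷_ ⊛ row) (transpose M) ⟩
  lookup (replicate n Vec._∷_ ⊛ row) c (lookup (transpose M) c)
    ≡⟨ cong (λ f → f (lookup (transpose M) c)) (lookup-⊛ c (replicate n Vec._∷_) row) ⟩
  lookup (replicate n Vec._∷_) c (lookup row c) (lookup (transpose M) c)
    ≡⟨ cong (λ f → f (lookup row c) (lookup (transpose M) c)) (lookup-replicate c Vec._∷_) ⟩
  lookup row c ∷ lookup (transpose M) c
    ≡⟨ cong (lookup row c ∷_) (lookup-transpose M c) ⟩
  lookup row c ∷ map (λ row → lookup row c) M
    ∎
  where open ≡-Reasoning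

Palindromic : (ℕ → A) → ℕ → Set
Palindromic g n = ∀ a b → suc (a + b) ≡ n → g a ≡ g b

palindrome⇒palindromic : (v : Vec A n) (g : ℕ → A) → (∀ k → lookup v k ≡ g (toℕ k)) →
                         Palindrome v → Palindromic g n
palindrome⇒palindromic {n = n} v g v≗g pal a b a+b<n = begin
  g a                    ≡⟨ cong g (sym (toℕ-fromℕ< a<n)) ⟩
  g (toℕ k)              ≡⟨ sym (v≗g k) ⟩
  lookup v k             ≡⟨ sym (lookup-reverse v k) ⟩
  lookup (reverse v) k̄   ≡⟨ cong (λ u → lookup u k̄) pal ⟩
  lookup v k̄             ≡⟨ v≗g k̄ ⟩
  g (toℕ k̄)              ≡⟨ cong g toℕ-k̄ ⟩
  g b                    ∎
  where
  open ≡-Reasoning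
  a<n : a < n
  a<n = subst (a <_) a+b<n (s≤s (m≤m+n a b))
  k k̄ : Fin n
  k = fromℕ< a<n
  k̄ = opposite k
  toℕ-k̄ : toℕ k̄ ≡ b
  toℕ-k̄ = begin
    toℕ k̄                 ≡⟨ opposite-prop k ⟩
    n ∸ suc (toℕ k)       ≡⟨ cong (λ z → n ∸ suc z) (toℕ-fromℕ< a<n) ⟩
    n ∸ suc a             ≡⟨ cong (_∸ suc a) (sym a+b<n) ⟩
    suc (a + b) ∸ suc a   ≡⟨ m+n∸m≡n a b ⟩
    b                     ∎

palindromic-inner : {g : ℕ → A} → Palindromic g (suc (suc n)) → Palindromic (g ∘ suc) n
palindromic-inner {n = n} pal a b a+b+1≡n =
  pal (suc a) (suc b) (cong (λ k → suc (suc k)) (trans (+-suc a b) a+b+1≡n))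

data Shape (A : Set) : Set where
  pair   : A → Shape A
  triple : A → A → Shape A

OccursAt : Shape A → (ℕ → A) → ℕ → Set
OccursAt (pair x)     g k = g k ≡ x × g (suc k) ≡ x
OccursAt (triple x y) g k = g k ≡ x × g (suc k) ≡ y × g (suc (suc k)) ≡ x

occursAt-suc : ∀ (s : Shape A) {g : ℕ → A} {k} → OccursAt s (g ∘ suc) k → OccursAt s g (suc k)
occursAt-suc (pair _)     occ = occ
occursAt-suc (triple _ _) occ = occ

occursAt-shift : ∀ {s : Shape A} {g : ℕ → A} {k} j → OccursAt s (λ b → g (j + b)) k → OccursAt s g (j + k)
occursAt-shift zero    occ = occ
occursAt-shift {s = s} {g} (suc j) occ = occursAt-suc s (occursAt-shift {g = g ∘ suc} j occ)

short-center : (g : ℕ → A) → ∀ n → Palindromic g (suc (suc n)) → ∃₂ λ s k → OccursAt s g k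
short-center g zero          pal = pair (g 0) , 0 , refl , sym (pal 0 1 refl)
short-center g (suc zero)    pal = triple (g 0) (g 1) , 0 , refl , refl , sym (pal 0 2 refl)
short-center g (suc (suc n)) pal with short-center (g ∘ suc) n (palindromic-inner pal)
... | s , k , occ = s , suc k , occursAt-suc s occ

-- Forbidding the centres xyx and xyyx forbids every palindromic factor of length at least 3.
record PairsOnly (P : A → Set) (g : ℕ → A) : Set where
  field
    pair-letter : ∀ k → g k ≡ g (suc k) → P (g k)
    no-xyx      : ∀ k → g k ≢ g (2 + k)
    no-xyyx     : ∀ k → g k ≡ g (3 + k) → g (suc k) ≢ g (2 + k)

m≢1+n+m : ∀ {n} m → m ≢ suc n + m
m≢1+n+m m = <⇒≢ (m<n+m m (s≤s z≤n))

module _ {P : A → Set} where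

  pairsOnly-suc : {g : ℕ → A} → PairsOnly P g → PairsOnly P (g ∘ suc)
  pairsOnly-suc po = record
    { pair-letter = pair-letter ∘ suc ; no-xyx = no-xyx ∘ suc ; no-xyyx = no-xyyx ∘ suc }
    where open PairsOnly po

  pairsOnly-shift : {g : ℕ → A} → ∀ j → PairsOnly P g → PairsOnly P (λ b → g (j + b))
  pairsOnly-shift zero    po = po
  pairsOnly-shift (suc j) po = pairsOnly-shift j (pairsOnly-suc po)

  no-long-palindrome : {g : ℕ → A} → PairsOnly P g → ∀ n → ¬ Palindromic g (3 + n)
  no-long-palindrome po zero          pal = PairsOnly.no-xyx po 0 (pal 0 2 refl)
  no-long-palindrome po (suc zero)    pal = PairsOnly.no-xyyx po 0 (pal 0 3 refl) (pal 1 2 refl)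
  no-long-palindrome po (suc (suc n)) pal =
    no-long-palindrome (pairsOnly-suc po) n (palindromic-inner pal)

  palindromeFree⇒pairsOnly : {g : ℕ → A} → (∀ k → g k ≢ g (suc k)) → (∀ k → g k ≢ g (2 + k)) → PairsOnly P g
  palindromeFree⇒pairsOnly no-xx no-xyx = record
    { pair-letter = λ k xx → ⊥-elim (no-xx k xx)
    ; no-xyx      = no-xyx
    ; no-xyyx     = λ k _ → no-xx (suc k)
    }

  pairsOnly-reflect : {B : Set} {g : ℕ → A} {g′ : ℕ → B} (ψ : B → A) →
    (∀ {k l} → k ≢ l → g′ k ≡ g′ l → g k ≡ g l × ψ (g′ k) ≡ g k) →
    PairsOnly P g → PairsOnly (P ∘ ψ) g′
  pairsOnly-reflect ψ reflect po = record
    { pair-letter = λ k eq → let e , ψe = reflect (m≢1+n+m k) eq in subst P (sym ψe) (pair-letter k e)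
    ; no-xyx      = λ k eq → no-xyx k (proj₁ (reflect (m≢1+n+m k) eq))
    ; no-xyyx     = λ k eq eq′ →
        no-xyyx k (proj₁ (reflect (m≢1+n+m k) eq)) (proj₁ (reflect (m≢1+n+m {0} (suc k)) eq′))
    }
    where
    open PairsOnly po

module _ (w : Word2D A) (i j : ℕ) where

  block-cell : (a : Fin m) (b : Fin n) → lookup (lookup (block w i j m n) a) b ≡ w (i + toℕ a) (j + toℕ b)
  block-cell a b = trans (cong (λ r → lookup r b) (lookup∘tabulate _ a)) (lookup∘tabulate _ b)

  -- Written with toℕ b + j so that, for a literal n, the right-hand side computes to w i j ∷ w i (suc j) ∷ …
  block-row : block w i j 1 n ≡ tabulate (λ b → w i (toℕ b + j)) ∷ []
  block-row = cong (_∷ []) (tabulate-cong λ b → cong₂ w (+-identityʳ i) (+-comm j (toℕ b)))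

  block-col : block w i j n 1 ≡ tabulate (λ a → w (toℕ a + i) j ∷ [])
  block-col = tabulate-cong λ a → cong (λ x → x ∷ []) (cong₂ w (+-comm i (toℕ a)) (+-identityʳ j))

  module _ (hv : HVPalindrome (m , n , block w i j m n)) where

    row-palindromic : (r : Fin m) → Palindromic (λ b → w (i + toℕ r) (j + b)) n
    row-palindromic r = palindrome⇒palindromic _ _ (block-cell r) (lookup⁺ (proj₁ hv) r)

    col-palindromic : (c : Fin n) → Palindromic (λ a → w (i + a) (j + toℕ c)) m
    col-palindromic c = palindrome⇒palindromic _ _ column≗ (lookup⁺ (proj₂ hv) c)
      where
      column≗ : ∀ a → lookup (lookup (transpose (block w i j m n)) c) a ≡ w (i + toℕ a) (j + toℕ c)
      column≗ a = begin
        lookup (lookup (transpose (block w i j m n)) c) a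
          ≡⟨ cong (λ v → lookup v a) (lookup-transpose (block w i j m n) c) ⟩
        lookup (map (λ row → lookup row c) (block w i j m n)) a
          ≡⟨ lookup-map a (λ row → lookup row c) (block w i j m n) ⟩
        lookup (lookup (block w i j m n) a) c
          ≡⟨ block-cell a c ⟩
        w (i + toℕ a) (j + toℕ c)
          ∎
        where open ≡-Reasoning

data Direction : Set where
  horizontal vertical : Direction

Short : Set → Set
Short A = Direction × Shape A

Occurs : Word2D A → Short A → ℕ → ℕ → Set
Occurs w (horizontal , s) i j = OccursAt s (w i) j
Occurs w (vertical   , s) i j = OccursAt s (λ a → w a j) i

toArray : Short A → Array A
toArray (horizontal , pair x)     = 1 , 2 , (x ∷ x ∷ []) ∷ []
toArray (horizontal , triple x y) = 1 , 3 , (x ∷ y ∷ x ∷ []) ∷ []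
toArray (vertical   , pair x)     = 2 , 1 , (x ∷ []) ∷ (x ∷ []) ∷ []
toArray (vertical   , triple x y) = 3 , 1 , (x ∷ []) ∷ (y ∷ []) ∷ (x ∷ []) ∷ []

toArray-injective : (t t′ : Short A) → toArray t ≡ toArray t′ → t ≡ t′
toArray-injective (horizontal , pair _)     (horizontal , pair _)     refl = refl
toArray-injective (horizontal , triple _ _) (horizontal , triple _ _) refl = refl
toArray-injective (vertical   , pair _)     (vertical   , pair _)     refl = refl
toArray-injective (vertical   , triple _ _) (vertical   , triple _ _) refl = refl
toArray-injective (horizontal , pair _)     (horizontal , triple _ _) ()
toArray-injective (horizontal , pair _)     (vertical   , pair _)     ()
toArray-injective (horizontal , pair _)     (vertical   , triple _ _) ()
toArray-injective (horizontal , triple _ _) (horizontal , pair _)     ()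
toArray-injective (horizontal , triple _ _) (vertical   , pair _)     ()
toArray-injective (horizontal , triple _ _) (vertical   , triple _ _) ()
toArray-injective (vertical   , pair _)     (horizontal , pair _)     ()
toArray-injective (vertical   , pair _)     (horizontal , triple _ _) ()
toArray-injective (vertical   , pair _)     (vertical   , triple _ _) ()
toArray-injective (vertical   , triple _ _) (horizontal , pair _)     ()
toArray-injective (vertical   , triple _ _) (horizontal , triple _ _) ()
toArray-injective (vertical   , triple _ _) (vertical   , pair _)     ()

toArray-nonTrivial : (t : Short A) → NonTrivial (toArray t)
toArray-nonTrivial (horizontal , pair _)     (_ , ())
toArray-nonTrivial (horizontal , triple _ _) (_ , ())
toArray-nonTrivial (vertical   , pair _)     (() , _)
toArray-nonTrivial (vertical   , triple _ _) (() , _)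

occurs⇒factor : (w : Word2D A) (t : Short A) {i j : ℕ} → Occurs w t i j → HVPalFactor w (toArray t)
occurs⇒factor w (horizontal , pair _) {i} {j} (refl , e₁) =
  (s≤s z≤n , s≤s z≤n , i , j ,
   trans (cong (λ y → (w i j ∷ y ∷ []) ∷ []) (sym e₁)) (sym (block-row w i j))) ,
  (refl ∷ []) , (refl ∷ refl ∷ [])
occurs⇒factor w (horizontal , triple _ _) {i} {j} (refl , refl , e₂) =
  (s≤s z≤n , s≤s z≤n , i , j ,
   trans (cong (λ y → (w i j ∷ w i (suc j) ∷ y ∷ []) ∷ []) (sym e₂)) (sym (block-row w i j))) ,
  (refl ∷ []) , (refl ∷ refl ∷ refl ∷ [])
occurs⇒factor w (vertical , pair _) {i} {j} (refl , e₁) =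
  (s≤s z≤n , s≤s z≤n , i , j ,
   trans (cong (λ y → (w i j ∷ []) ∷ (y ∷ []) ∷ []) (sym e₁)) (sym (block-col w i j))) ,
  (refl ∷ refl ∷ []) , (refl ∷ [])
occurs⇒factor w (vertical , triple _ _) {i} {j} (refl , refl , e₂) =
  (s≤s z≤n , s≤s z≤n , i , j ,
   trans (cong (λ y → (w i j ∷ []) ∷ (w (suc i) j ∷ []) ∷ (y ∷ []) ∷ []) (sym e₂)) (sym (block-col w i j))) ,
  (refl ∷ refl ∷ refl ∷ []) , (refl ∷ [])

nonTrivial⇒short : (w : Word2D A) → HasNonTrivialHVPal w → ∃ λ t → ∃₂ (Occurs w t)
nonTrivial⇒short w ((zero , _ , _) , ((() , _) , _) , _)
nonTrivial⇒short w ((suc _ , zero , _) , ((_ , () , _) , _) , _)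
nonTrivial⇒short w ((suc zero , suc zero , _) , _ , nonTrivial) = ⊥-elim (nonTrivial (refl , refl))
nonTrivial⇒short w ((suc m , suc (suc n) , _) , ((_ , _ , i , j , refl) , hv) , _)
  with short-center _ n (row-palindromic w i j hv zero)
... | s , k , occ = (horizontal , s) , i + 0 , j + k , occursAt-shift j occ
nonTrivial⇒short w ((suc (suc m) , suc zero , _) , ((_ , _ , i , j , refl) , hv) , _)
  with short-center _ m (col-palindromic w i j hv zero)
... | s , k , occ = (vertical , s) , i + k , j + 0 , occursAt-shift i occ

flipShort : Short A → Short A
flipShort (horizontal , s) = vertical , s
flipShort (vertical   , s) = horizontal , s

flipShort-involutive : (t : Short A) → flipShort (flipShort t) ≡ t
flipShort-involutive (horizontal , _) = refl
flipShort-involutive (vertical   , _) = refl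

occurs-transpose : (w : Word2D A) (t : Short A) {i j : ℕ} →
                   Occurs (λ a b → w b a) t i j → Occurs w (flipShort t) j i
occurs-transpose w (horizontal , _) occ = occ
occurs-transpose w (vertical   , _) occ = occ

sing : A → Array A
sing x = 1 , 1 , (x ∷ []) ∷ []

sing-injective : {x y : A} → sing x ≡ sing y → x ≡ y
sing-injective refl = refl

sing-factor : (w : Word2D A) {x : A} {i j : ℕ} → w i j ≡ x → HVPalFactor w (sing x)
sing-factor w {i = i} {j} refl = (s≤s z≤n , s≤s z≤n , i , j , sym (block-row w i j)) , (refl ∷ []) , (refl ∷ [])

trivial-or-nonTrivial : (F : Array A) → (∃ λ x → F ≡ sing x) ⊎ NonTrivial F
trivial-or-nonTrivial (suc zero , suc zero , (x ∷ []) ∷ []) = inj₁ (x , refl)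
trivial-or-nonTrivial (zero , _ , _)                         = inj₂ λ { (() , _) }
trivial-or-nonTrivial (suc (suc _) , _ , _)                  = inj₂ λ { (() , _) }
trivial-or-nonTrivial (suc zero , zero , _)                  = inj₂ λ { (_ , ()) }
trivial-or-nonTrivial (suc zero , suc (suc _) , _)           = inj₂ λ { (_ , ()) }

singletons : ∀ q → List (Array (Fin q))
singletons q = List.map sing (allFin q)

length-singletons : ∀ q → length (singletons q) ≡ q
length-singletons q = trans (length-map sing (allFin q)) (length-tabulate id)

module Counting {q : ℕ} (w : Word2D (Fin q)) (uses : UsesAll w) {ys : List (Array (Fin q))}
  (ys-unique : Unique ys) (ys-factors : All (HVPalFactor w) ys) (ys-nonTrivial : All NonTrivial ys) where

  private
    xs : List (Array (Fin q))
    xs = ys ++ singletons q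

    length-xs : length xs ≡ length ys + q
    length-xs = trans (length-++ ys) (cong (length ys +_) (length-singletons q))

    disjoint : Disjoint ys (singletons q)
    disjoint (F∈ys , F∈singletons) with ∈-map⁻ sing F∈singletons
    ... | x , _ , refl = All.lookup ys-nonTrivial F∈ys (refl , refl)

    unique-xs : Unique xs
    unique-xs = Unique.++⁺ ys-unique (Unique.map⁺ sing-injective (Unique.allFin⁺ q)) disjoint

    factors-xs : All (HVPalFactor w) xs
    factors-xs = All.++⁺ ys-factors (All.map⁺ (All.tabulate λ {x} _ → sing-factor w (proj₂ (proj₂ (uses x)))))

  at-least : AtLeastHVPal w (length ys + q)
  at-least = xs , length-xs , unique-xs , factors-xs

  exactly : (∀ F → HVPalFactor w F → NonTrivial F → F ∈ ys) → ExactlyHVPal w (length ys + q)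
  exactly complete = xs , length-xs , unique-xs , factors-xs , λ F hv → member F hv (trivial-or-nonTrivial F)
    where
    member : ∀ F → HVPalFactor w F → (∃ λ x → F ≡ sing x) ⊎ NonTrivial F → F ∈ xs
    member F _  (inj₁ (x , refl)) = ∈-++⁺ʳ ys (∈-map⁺ sing (∈-allFin x))
    member F hv (inj₂ nonTrivial) = ∈-++⁺ˡ (complete F hv nonTrivial)

lower-bound : ∀ q (w : Word2D (Fin q)) → UsesAll w → HasNonTrivialHVPal w → AtLeastHVPal w (suc q)
lower-bound q w uses (F , factor , nonTrivial) =
  Counting.at-least w uses ([] ∷ []) (factor ∷ []) (nonTrivial ∷ [])

-- Three letters

occursAt-head : (s : Shape A) {g h : ℕ → A} {k : ℕ} → OccursAt s g k → OccursAt s h k → g k ≡ h k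
occursAt-head (pair _)     (e , _)     (f , _)     = trans e (sym f)
occursAt-head (triple _ _) (e , _ , _) (f , _ , _) = trans e (sym f)

Rainbow : A → A → A → Set
Rainbow x y z = x ≢ y × y ≢ z × x ≢ z

module _ {x y z : A} where

  rainbow-rotate : Rainbow x y z → Rainbow y z x
  rainbow-rotate (x≢y , y≢z , x≢z) = y≢z , x≢z ∘ sym , x≢y ∘ sym

  rainbow-swap : Rainbow x y z → Rainbow x z y
  rainbow-swap (x≢y , y≢z , x≢z) = x≢z , y≢z ∘ sym , x≢y

occursAt⇒¬rainbow : (s : Shape A) {g : ℕ → A} {k : ℕ} →
                    OccursAt s g k → ¬ Rainbow (g k) (g (suc k)) (g (suc (suc k)))
occursAt⇒¬rainbow (pair _)     (e₀ , e₁)     (x≢y , _ , _) = x≢y (trans e₀ (sym e₁))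
occursAt⇒¬rainbow (triple _ _) (e₀ , _ , e₂) (_ , _ , x≢z) = x≢z (trans e₀ (sym e₂))

RainbowOrShort : (ℕ → A) → ℕ → Set
RainbowOrShort g k =
  Rainbow (g k) (g (suc k)) (g (suc (suc k))) ⊎ (∃ λ s → OccursAt s g k) ⊎ OccursAt (pair (g (suc k))) g (suc k)

rainbow-or-short : DecidableEquality A → (g : ℕ → A) (k : ℕ) → RainbowOrShort g k
rainbow-or-short _≟ᴬ_ g k with g k ≟ᴬ g (suc k) | g (suc k) ≟ᴬ g (suc (suc k)) | g k ≟ᴬ g (suc (suc k))
... | yes x≡y | _       | _       = inj₂ (inj₁ (pair (g k) , refl , sym x≡y))
... | _       | yes y≡z | _       = inj₂ (inj₂ (refl , sym y≡z))
... | _       | _       | yes x≡z = inj₂ (inj₁ (triple (g k) (g (suc k)) , refl , refl , sym x≡z))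
... | no x≢y  | no y≢z  | no x≢z  = inj₁ (x≢y , y≢z , x≢z)

≢-both⇒≡ : {x y t u : Fin 3} → x ≢ y → t ≢ x → t ≢ y → u ≢ x → u ≢ y → t ≡ u
≢-both⇒≡ {x} {y} {t} {u} = from-yes
  (all? λ (x : Fin 3) → all? λ (y : Fin 3) → all? λ (t : Fin 3) → all? λ (u : Fin 3) →
     ¬? (x ≟ y) →-dec ¬? (t ≟ x) →-dec ¬? (t ≟ y) →-dec ¬? (u ≟ x) →-dec ¬? (u ≟ y) →-dec t ≟ u)
  x y t u

-- If the top letters of the first two columns agreed, the second column would be the first with
-- its lower two letters swapped, and both lower letters of the third column would be that top letter.
top-letters-differ : {a b c a′ b′ c′ a″ b″ c″ : Fin 3} →
  Rainbow a b c → Rainbow a′ b′ c′ → Rainbow a″ b″ c″ → Rainbow b b′ b″ → Rainbow c c′ c″ → a ≢ a′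
top-letters-differ {a} {b} {c} {_} {b′} {c′} {_} {b″} {c″}
  (a≢b , b≢c , a≢c) (a≢b′ , _ , a≢c′) (_ , b″≢c″ , _) (b≢b′ , b′≢b″ , b≢b″) (c≢c′ , c′≢c″ , c≢c″) refl =
  b″≢c″ (trans b″≡a (sym c″≡a))
  where
  b′≡c : b′ ≡ c
  b′≡c = ≢-both⇒≡ a≢b (a≢b′ ∘ sym) (b≢b′ ∘ sym) (a≢c ∘ sym) (b≢c ∘ sym)
  c′≡b : c′ ≡ b
  c′≡b = ≢-both⇒≡ a≢c (a≢c′ ∘ sym) (c≢c′ ∘ sym) (a≢b ∘ sym) b≢c
  b″≡a : b″ ≡ a
  b″≡a = ≢-both⇒≡ b≢c (b≢b″ ∘ sym) (λ e → b′≢b″ (trans b′≡c (sym e))) a≢b a≢c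
  c″≡a : c″ ≡ a
  c″≡a = ≢-both⇒≡ b≢c (λ e → c′≢c″ (trans c′≡b (sym e))) (c≢c″ ∘ sym) a≢b a≢c

rainbow-top-row : {a₀ a₁ a₂ b₀ b₁ b₂ c₀ c₁ c₂ : Fin 3} →
  Rainbow a₀ b₀ c₀ → Rainbow a₁ b₁ c₁ → Rainbow a₂ b₂ c₂ →
  Rainbow b₀ b₁ b₂ → Rainbow c₀ c₁ c₂ → Rainbow a₀ a₁ a₂
rainbow-top-row col₀ col₁ col₂ b c =
  top-letters-differ col₀ col₁ col₂ b c ,
  top-letters-differ col₁ col₂ col₀ (rainbow-rotate b) (rainbow-rotate c) ,
  top-letters-differ col₀ col₂ col₁ (rainbow-swap b) (rainbow-swap c)

module _ (w : Word2D (Fin 3)) (s : Shape (Fin 3)) {i j : ℕ} (occ : Occurs w (horizontal , s) i j) where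

  private
    AnotherShort : Set
    AnotherShort = ∃ λ t → t ≢ (horizontal , s) × ∃₂ (Occurs w t)

    column : ∀ c → RainbowOrShort (λ a → w a c) i
    column c = rainbow-or-short _≟_ (λ a → w a c) i

    row : ∀ r → RainbowOrShort (w r) j
    row r = rainbow-or-short _≟_ (w r) j

    vertical-short : ∀ {c} →
      (∃ λ t → OccursAt t (λ a → w a c) i) ⊎ OccursAt (pair (w (suc i) c)) (λ a → w a c) (suc i) → AnotherShort
    vertical-short {c} (inj₁ (t , o)) = (vertical , t) , (λ ()) , i , c , o
    vertical-short {c} (inj₂ o)       = (vertical , pair _) , (λ ()) , suc i , c , o

    horizontal-short : ∀ {r} → w i j ≢ w r j → w i (suc j) ≢ w r (suc j) →
      (∃ λ t → OccursAt t (w r) j) ⊎ OccursAt (pair (w r (suc j))) (w r) (suc j) → AnotherShort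
    horizontal-short {r} a₀≢ _ (inj₁ (t , o)) =
      (horizontal , t) ,
      (λ eq → a₀≢ (occursAt-head s occ (subst (λ u → OccursAt u (w r) j) (cong proj₂ eq) o))) ,
      r , j , o
    horizontal-short {r} _ a₁≢ (inj₂ o) =
      (horizontal , pair _) ,
      (λ eq → a₁≢ (proj₂ (subst (λ u → OccursAt u (w i) j) (sym (cong proj₂ eq)) occ))) ,
      r , suc j , o

  -- Three rainbow columns under a short palindrome force a repeated letter in a lower row.
  another-short : AnotherShort
  another-short with column j | column (suc j) | column (suc (suc j)) | row (suc i) | row (suc (suc i))
  ... | inj₂ short | _          | _          | _          | _          = vertical-short short
  ... | inj₁ _     | inj₂ short | _          | _          | _          = vertical-short short
  ... | inj₁ _     | inj₁ _     | inj₂ short | _          | _          = vertical-short short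
  ... | inj₁ col₀  | inj₁ col₁  | inj₁ _     | inj₂ short | _          =
    horizontal-short (proj₁ col₀) (proj₁ col₁) short
  ... | inj₁ col₀  | inj₁ col₁  | inj₁ _     | inj₁ _     | inj₂ short =
    horizontal-short (proj₂ (proj₂ col₀)) (proj₂ (proj₂ col₁)) short
  ... | inj₁ col₀  | inj₁ col₁  | inj₁ col₂  | inj₁ row₁  | inj₁ row₂  =
    ⊥-elim (occursAt⇒¬rainbow s occ (rainbow-top-row col₀ col₁ col₂ row₁ row₂))

two-shorts : (w : Word2D (Fin 3)) → HasNonTrivialHVPal w →
  ∃₂ λ t t′ → t ≢ t′ × ∃₂ (Occurs w t) × ∃₂ (Occurs w t′)
two-shorts w nt with nonTrivial⇒short w nt
... | (horizontal , s) , i , j , occ with another-short w s occ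
...   | t′ , t′≢t , pos′ = (horizontal , s) , t′ , t′≢t ∘ sym , (i , j , occ) , pos′
two-shorts w nt | (vertical , s) , i , j , occ with another-short (λ a b → w b a) s occ
...   | t′ , t′≢t , i′ , j′ , occ′ =
  (vertical , s) , flipShort t′ ,
  (λ eq → t′≢t (trans (sym (flipShort-involutive t′)) (cong flipShort (sym eq)))) ,
  (i , j , occ) , (j′ , i′ , occurs-transpose w t′ occ′)

lower-bound₃ : (w : Word2D (Fin 3)) → UsesAll w → HasNonTrivialHVPal w → AtLeastHVPal w 5
lower-bound₃ w uses nt with two-shorts w nt
... | t , t′ , t≢t′ , (_ , _ , occ) , (_ , _ , occ′) =
  Counting.at-least w uses ((t≢t′ ∘ toArray-injective t t′ ∷ []) ∷ [] ∷ [])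
    (occurs⇒factor w t occ ∷ occurs⇒factor w t′ occ′ ∷ [])
    (toArray-nonTrivial t ∷ toArray-nonTrivial t′ ∷ [])

-- Words whose rows and columns avoid xyx and xyyx

record PairsOnly² (Ph Pv : A → Set) (w : Word2D A) : Set where
  field
    rows               : ∀ i → PairsOnly Ph (w i)
    cols               : ∀ j → PairsOnly Pv (λ i → w i j)
    no-constant-square : ∀ i j → w i j ≡ w i (suc j) → w i j ≡ w (suc i) j → w i j ≢ w (suc i) (suc j)

module _ {Ph Pv : A → Set} {w : Word2D A} (po : PairsOnly² Ph Pv w) where
  open PairsOnly² po

  only-pair-factors : ∀ F → HVPalFactor w F → NonTrivial F →
    (∃ λ x → Ph x × F ≡ toArray (horizontal , pair x)) ⊎ (∃ λ x → Pv x × F ≡ toArray (vertical , pair x))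
  only-pair-factors (zero , _ , _)             ((() , _) , _) _
  only-pair-factors (suc _ , zero , _)         ((_ , () , _) , _) _
  only-pair-factors (suc zero , suc zero , _)  _ nonTrivial = ⊥-elim (nonTrivial (refl , refl))
  only-pair-factors (suc m , suc (suc (suc n)) , _) ((_ , _ , i , j , refl) , hv) _ =
    ⊥-elim (no-long-palindrome (pairsOnly-shift j (rows (i + 0))) n (row-palindromic w i j hv zero))
  only-pair-factors (suc (suc (suc m)) , suc n , _) ((_ , _ , i , j , refl) , hv) _ =
    ⊥-elim (no-long-palindrome (pairsOnly-shift i (cols (j + 0))) m (col-palindromic w i j hv zero))
  only-pair-factors (suc zero , suc (suc zero) , _) ((_ , _ , i , j , refl) , hv) _ =
    inj₁ (_ , PairsOnly.pair-letter (pairsOnly-shift j (rows (i + 0))) 0 xx ,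
          cong (λ y → 1 , 2 , (w (i + 0) (j + 0) ∷ y ∷ []) ∷ []) (sym xx))
    where xx = row-palindromic w i j hv zero 0 1 refl
  only-pair-factors (suc (suc zero) , suc zero , _) ((_ , _ , i , j , refl) , hv) _ =
    inj₂ (_ , PairsOnly.pair-letter (pairsOnly-shift i (cols (j + 0))) 0 xx ,
          cong (λ y → 2 , 1 , (w (i + 0) (j + 0) ∷ []) ∷ (y ∷ []) ∷ []) (sym xx))
    where xx = col-palindromic w i j hv zero 0 1 refl
  only-pair-factors (suc (suc zero) , suc (suc zero) , _) ((_ , _ , i , j , refl) , hv) _ =
    ⊥-elim (no-constant-square (i + 0) (j + 0)
      (trans top (cong (w (i + 0)) (+-suc j 0)))
      (trans left (cong (λ a → w a (j + 0)) (+-suc i 0)))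
      (trans (trans left bottom) (cong₂ w (+-suc i 0) (+-suc j 0))))
    where
    top    = row-palindromic w i j hv zero 0 1 refl
    bottom = row-palindromic w i j hv (suc zero) 0 1 refl
    left   = col-palindromic w i j hv zero 0 1 refl

pairsOnly²-reflect : {B : Set} {Ph Pv : A → Set} {w : Word2D A} {w′ : Word2D B} (ψ : B → A) →
  (∀ {i j k l} → (i , j) ≢ (k , l) → w′ i j ≡ w′ k l → w i j ≡ w k l × ψ (w′ i j) ≡ w i j) →
  PairsOnly² Ph Pv w → PairsOnly² (Ph ∘ ψ) (Pv ∘ ψ) w′
pairsOnly²-reflect ψ reflect po = record
  { rows = λ i → pairsOnly-reflect ψ (λ k≢l → reflect (k≢l ∘ cong proj₂)) (rows i)
  ; cols = λ j → pairsOnly-reflect ψ (λ k≢l → reflect (k≢l ∘ cong proj₁)) (cols j)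
  ; no-constant-square = λ i j e₁ e₂ e₃ → no-constant-square i j
      (proj₁ (reflect (m≢1+n+m j ∘ cong proj₂) e₁))
      (proj₁ (reflect (m≢1+n+m i ∘ cong proj₁) e₂))
      (proj₁ (reflect (m≢1+n+m i ∘ cong proj₁) e₃))
  }
  where open PairsOnly² po

module _ {q : ℕ} (w : Word2D ℕ) (bounded : ∀ i j → w i j < q) where

  toFin : Word2D (Fin q)
  toFin i j = fromℕ< (bounded i j)

  toℕ-toFin : ∀ i j → toℕ (toFin i j) ≡ w i j
  toℕ-toFin i j = toℕ-fromℕ< (bounded i j)

  toFin-pairsOnly² : {Ph Pv : ℕ → Set} → PairsOnly² Ph Pv w → PairsOnly² (Ph ∘ toℕ) (Pv ∘ toℕ) toFin
  toFin-pairsOnly² = pairsOnly²-reflect toℕ λ {i} {j} {k} {l} _ eq →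
    trans (sym (toℕ-toFin i j)) (trans (cong toℕ eq) (toℕ-toFin k l)) , toℕ-toFin i j

  toFin-usesAll : (∀ n → n < q → ∃₂ λ i j → w i j ≡ n) → UsesAll toFin
  toFin-usesAll hits a with hits (toℕ a) (toℕ<n a)
  ... | i , j , wij≡a = i , j , toℕ-injective (trans (toℕ-toFin i j) wij≡a)

-- The two constructions

-- The implicit argument is the check of Q on 0, …, p ∸ 1, discharged by evaluation; for the
-- periodic patterns below the step holds by computation, so it is id.
periodic : ∀ p .{{_ : NonZero p}} {Q : ℕ → Set} (Q? : Decidable Q) → (∀ {t} → Q t → Q (p + t)) →
           {True (allUpTo? Q? p)} → ∀ t → Q t
periodic p {Q} Q? step {checked} = <-rec Q go
  where
  go : ∀ t → (∀ {u} → u < t → Q u) → Q t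
  go t rec with t <? p
  ... | yes t<p = toWitness checked t<p
  ... | no  t≮p = subst Q (m+[n∸m]≡n p≤t) (step (rec (∸-monoʳ-< (>-nonZero⁻¹ p) p≤t)))
    where p≤t = ≮⇒≥ t≮p

pattern 4+_ t = suc (suc (suc (suc t)))

pat4 : ℕ → ℕ
pat4 0      = 0
pat4 1      = 0
pat4 2      = 1
pat4 3      = 2
pat4 (4+ t) = pat4 t

pat4-pairsOnly : PairsOnly (_≡ 0) pat4
pat4-pairsOnly = record
  { pair-letter = periodic 4 (λ t → pat4 t ℕ.≟ pat4 (suc t) →-dec pat4 t ℕ.≟ 0) id
  ; no-xyx      = periodic 4 (λ t → ¬? (pat4 t ℕ.≟ pat4 (2 + t))) id
  ; no-xyyx     = periodic 4 (λ t → pat4 t ℕ.≟ pat4 (3 + t) →-dec ¬? (pat4 (suc t) ℕ.≟ pat4 (2 + t))) id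
  }

pat4<3 : ∀ t → pat4 t < 3
pat4<3 = periodic 4 (λ t → pat4 t <? 3) id

diagonal : Word2D ℕ
diagonal i j = pat4 (i + j)

diagonal-pairsOnly² : PairsOnly² (_≡ 0) (_≡ 0) diagonal
diagonal-pairsOnly² = record
  { rows = λ i → pairsOnly-shift i pat4-pairsOnly
  ; cols = λ j → pairsOnly-reflect id (λ {k} {l} _ e → trans (comm j k) (trans e (comm l j)) , comm k j)
                   (pairsOnly-shift j pat4-pairsOnly)
  ; no-constant-square = λ i j _ _ diag →
      PairsOnly.no-xyx pat4-pairsOnly (i + j) (trans diag (cong (pat4 ∘ suc) (+-suc i j)))
  }
  where
  comm : ∀ a b → pat4 (a + b) ≡ pat4 (b + a)
  comm a b = cong pat4 (+-comm a b)

upper-bound₃ : ∃ λ (w : Word2D (Fin 3)) → UsesAll w × HasNonTrivialHVPal w × ExactlyHVPal w 5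
upper-bound₃ = w , uses , (toArray pair₀ , factor , toArray-nonTrivial pair₀) ,
  Counting.exactly w uses (((λ ()) ∷ []) ∷ [] ∷ []) (factor ∷ occurs⇒factor w vpair₀ {0} {0} (refl , refl) ∷ [])
    (toArray-nonTrivial pair₀ ∷ toArray-nonTrivial vpair₀ ∷ [])
    λ F hv nt → member (only-pair-factors (toFin-pairsOnly² diagonal bounded diagonal-pairsOnly²) F hv nt)
  where
  bounded : ∀ i j → diagonal i j < 3
  bounded i j = pat4<3 (i + j)
  w : Word2D (Fin 3)
  w = toFin diagonal bounded
  hits : ∀ n → n < 3 → ∃₂ λ i j → diagonal i j ≡ n
  hits 0 _ = 0 , 0 , refl
  hits 1 _ = 0 , 2 , refl
  hits 2 _ = 0 , 3 , refl
  hits (suc (suc (suc _))) (s≤s (s≤s (s≤s ())))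
  uses : UsesAll w
  uses = toFin-usesAll diagonal bounded hits
  pair₀ vpair₀ : Short (Fin 3)
  pair₀ = horizontal , pair zero
  vpair₀ = vertical , pair zero
  factor : HVPalFactor w (toArray pair₀)
  factor = occurs⇒factor w pair₀ {0} {0} (refl , refl)
  member : ∀ {F} → (∃ λ x → toℕ x ≡ 0 × F ≡ toArray (horizontal , pair x)) ⊎
                   (∃ λ x → toℕ x ≡ 0 × F ≡ toArray (vertical , pair x)) →
           F ∈ toArray pair₀ ∷ toArray vpair₀ ∷ []
  member (inj₁ (x , x≡0 , refl)) = here (cong (λ y → toArray (horizontal , pair y)) (toℕ-injective x≡0))
  member (inj₂ (x , x≡0 , refl)) = there (here (cong (λ y → toArray (vertical , pair y)) (toℕ-injective x≡0)))

pat8 : ℕ → ℕ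
pat8 0           = 0
pat8 1           = 0
pat8 2           = 1
pat8 3           = 2
pat8 4           = 3
pat8 5           = 1
pat8 6           = 2
pat8 7           = 3
pat8 (4+ (4+ t)) = pat8 t

pat8-pairsOnly : PairsOnly (_≡ 0) pat8
pat8-pairsOnly = record
  { pair-letter = periodic 8 (λ t → pat8 t ℕ.≟ pat8 (suc t) →-dec pat8 t ℕ.≟ 0) id
  ; no-xyx      = periodic 8 (λ t → ¬? (pat8 t ℕ.≟ pat8 (2 + t))) id
  ; no-xyyx     = periodic 8 (λ t → pat8 t ℕ.≟ pat8 (3 + t) →-dec ¬? (pat8 (suc t) ℕ.≟ pat8 (2 + t))) id
  }

pat8-4-apart : ∀ t → pat8 t ≢ pat8 (4 + t)
pat8-4-apart = periodic 8 (λ t → ¬? (pat8 t ℕ.≟ pat8 (4 + t))) id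

pat8<4 : ∀ t → pat8 t < 4
pat8<4 = periodic 8 (λ t → pat8 t <? 4) id

grid : Word2D ℕ
grid i j = pat8 (i * 2 + j)

grid-cols : ∀ j → PairsOnly (λ _ → ⊥) (λ i → grid i j)
grid-cols j = palindromeFree⇒pairsOnly (λ k → PairsOnly.no-xyx pat8-pairsOnly (k * 2 + j))
                                       (λ k → pat8-4-apart (k * 2 + j))

grid-pairsOnly² : PairsOnly² (_≡ 0) (λ _ → ⊥) grid
grid-pairsOnly² = record
  { rows = λ i → pairsOnly-shift (i * 2) pat8-pairsOnly
  ; cols = grid-cols
  ; no-constant-square = λ i j _ vertical-pair _ → PairsOnly.pair-letter (grid-cols j) i vertical-pair
  }

module Freshened (e : ℕ) where

  word : Word2D ℕ
  word zero j with j <? e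
  ... | yes _ = 4 + j
  ... | no  _ = grid zero j
  word (suc i) j = grid (suc i) j

  fresh-or-grid : ∀ i j → (i ≡ 0 × j < e × word i j ≡ 4 + j) ⊎ word i j ≡ grid i j
  fresh-or-grid zero j with j <? e
  ... | yes j<e = inj₁ (refl , j<e , refl)
  ... | no  _   = inj₂ refl
  fresh-or-grid (suc i) j = inj₂ refl

  fresh : ∀ {j} → j < e → word 0 j ≡ 4 + j
  fresh {j} j<e with j <? e
  ... | yes _  = refl
  ... | no j≮e = ⊥-elim (j≮e j<e)

  bounded : ∀ i j → word i j < 4 + e
  bounded i j with fresh-or-grid i j
  ... | inj₁ (_ , j<e , f) = subst (_< 4 + e) (sym f) (+-monoʳ-< 4 j<e)
  ... | inj₂ g             = subst (_< 4 + e) (sym g) (≤-trans (pat8<4 (i * 2 + j)) (m≤m+n 4 e))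

  reflects : ∀ {i j k l} → (i , j) ≢ (k , l) → word i j ≡ word k l →
             grid i j ≡ grid k l × word i j ≡ grid i j
  reflects {i} {j} {k} {l} ij≢kl eq with fresh-or-grid i j | fresh-or-grid k l
  ... | inj₂ g | inj₂ g′ = trans (sym g) (trans eq g′) , g
  ... | inj₁ (refl , _ , f) | inj₁ (refl , _ , f′) =
    ⊥-elim (ij≢kl (cong (0 ,_) (+-cancelˡ-≡ 4 j l (trans (sym f) (trans eq f′)))))
  ... | inj₂ g | inj₁ (_ , _ , f′) =
    ⊥-elim (m+n≮m 4 l (subst (_< 4) (trans (sym g) (trans eq f′)) (pat8<4 (i * 2 + j))))
  ... | inj₁ (_ , _ , f) | inj₂ g′ =
    ⊥-elim (m+n≮m 4 j (subst (_< 4) (trans (sym g′) (trans (sym eq) f)) (pat8<4 (k * 2 + l))))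

  pairsOnly² : PairsOnly² (_≡ 0) (λ _ → ⊥) word
  pairsOnly² = pairsOnly²-reflect id reflects grid-pairsOnly²

  hits : ∀ n → n < 4 + e → ∃₂ λ i j → word i j ≡ n
  hits 0 _ = 1 , 6 , refl
  hits 1 _ = 1 , 0 , refl
  hits 2 _ = 1 , 1 , refl
  hits 3 _ = 1 , 2 , refl
  hits (4+ k) (s≤s (s≤s (s≤s (s≤s k<e)))) = 0 , k , fresh k<e

upper-bound : ∀ e →
  ∃ λ (w : Word2D (Fin (4 + e))) → UsesAll w × HasNonTrivialHVPal w × ExactlyHVPal w (suc (4 + e))
upper-bound e = w , uses , (toArray pair₀ , factor , toArray-nonTrivial pair₀) ,
  Counting.exactly w uses ([] ∷ []) (factor ∷ []) (toArray-nonTrivial pair₀ ∷ [])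
    λ F hv nt → member (only-pair-factors (toFin-pairsOnly² word bounded pairsOnly²) F hv nt)
  where
  open Freshened e
  w : Word2D (Fin (4 + e))
  w = toFin word bounded
  uses : UsesAll w
  uses = toFin-usesAll word bounded hits
  pair₀ : Short (Fin (4 + e))
  pair₀ = horizontal , pair zero
  factor : HVPalFactor w (toArray pair₀)
  factor = occurs⇒factor w pair₀ {1} {6} (refl , refl)
  member : ∀ {F} → (∃ λ x → toℕ x ≡ 0 × F ≡ toArray (horizontal , pair x)) ⊎
                   (∃ λ x → ⊥ × F ≡ toArray (vertical , pair x)) →
           F ∈ toArray pair₀ ∷ []
  member (inj₁ (x , x≡0 , refl)) = here (cong (λ y → toArray (horizontal , pair y)) (toℕ-injective x≡0))
  member (inj₂ (_ , () , _))

theorem5p13 : L'≡ 3 5 × ((q : ℕ) → q > 3 → L'≡ q (suc q))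
theorem5p13 = (upper-bound₃ , lower-bound₃) , beyond-three
  where
  beyond-three : (q : ℕ) → q > 3 → L'≡ q (suc q)
  beyond-three (4+ e) (s≤s (s≤s (s≤s (s≤s z≤n)))) = upper-bound e , lower-bound (4 + e)
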